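{- Let $k \geq 2$ be an integer and let $G=(D\cup I,E)$ be a split graph. If the corresponding hypergraph $H(G)$ admits a bipanchromatic $k$-coloring, then $G$ has $k$ completely independent spanning trees.
   Context: All graphs are finite, simple and undirected. A split graph $G=(D\cup I,E)$ is a graph whose vertex set is partitioned into a clique $D$ and an independent set $I$; the paper assumes throughout that every vertex of $D$ is adjacent to at least one vertex of $I$. Its corresponding hypergraph is $H(G)=(D,\mathcal{E})$ with $\mathcal{E}=\{N_G(x) : x\in I\}$ (one hyperedge $N_G(x)$ for each $x\in I$). A panchromatic $k$-coloring of a hypergraph is an assignment of colors from $\{1,\dots,k\}$ to its vertices such that every hyperedge contains at least one vertex of each of the $k$ colors. It is bipanchromatic if moreover each of the $k$ colors is assigned to at least two vertices of the hypergraph. Spanning trees $T_1,\dots,T_k$ of a graph are completely independent spanning trees if for every pair of vertices $x,y$ the $(x,y)$-paths in $T_1,\dots,T_k$ are pairwise edge-disjoint and have no common internal vertex. -}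

module Defs where

open import Data.Nat using (ℕ; _≤_)
open import Data.Fin using (Fin)
open import Data.Bool using (Bool; true; false)
open import Data.List using (List; []; _∷_; length)
open import Data.List.Membership.Propositional using (_∈_)
open import Data.List.Relation.Unary.Unique.Propositional using (Unique)
open import Data.Product using (Σ; ∃; _×_; _,_)
open import Data.Sum using (_⊎_)
open import Relation.Binary.PropositionalEquality using (_≡_; _≢_)
open import Relation.Nullary using (¬_)

record Graph (n : ℕ) : Set₁ where
  field
    Adj    : Fin n → Fin n → Set
    sym    : ∀ {x y} → Adj x y → Adj y x
    irrefl : ∀ {x} → ¬ Adj x x
open Graph public

data Walk {n : ℕ} (A : Fin n → Fin n → Set) : Fin n → Fin n → List (Fin n) → Set where
  stop : ∀ {x} → Walk A x x (x ∷ [])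
  step : ∀ {x y z vs} → A x y → Walk A y z vs → Walk A x z (x ∷ vs)

IsPath : {n : ℕ} (A : Fin n → Fin n → Set) → Fin n → Fin n → List (Fin n) → Set
IsPath A x y vs = Walk A x y vs × Unique vs

data EdgeOf {n : ℕ} : List (Fin n) → Fin n → Fin n → Set where
  here  : ∀ {u v vs} → EdgeOf (u ∷ v ∷ vs) u v
  there : ∀ {w u v vs} → EdgeOf vs u v → EdgeOf (w ∷ vs) u v

HasCycle : {n : ℕ} (A : Fin n → Fin n → Set) → Set
HasCycle {n} A = Σ (Fin n) λ x → Σ (Fin n) λ y → Σ (List (Fin n)) λ vs →
  IsPath A x y vs × 3 ≤ length vs × A y x

Connected : {n : ℕ} (A : Fin n → Fin n → Set) → Set
Connected {n} A = ∀ (x y : Fin n) → ∃ λ vs → IsPath A x y vs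

record SpanningTree {n : ℕ} (G : Graph n) : Set₁ where
  field
    TAdj      : Fin n → Fin n → Set
    sub       : ∀ {x y} → TAdj x y → Adj G x y
    tsym      : ∀ {x y} → TAdj x y → TAdj y x
    connected : Connected TAdj
    acyclic   : ¬ HasCycle TAdj
open SpanningTree public

ShareEdge : {n : ℕ} → List (Fin n) → List (Fin n) → Set
ShareEdge {n} P Q = Σ (Fin n) λ u → Σ (Fin n) λ v → EdgeOf P u v × (EdgeOf Q u v ⊎ EdgeOf Q v u)

ShareInternal : {n : ℕ} → Fin n → Fin n → List (Fin n) → List (Fin n) → Set
ShareInternal {n} x y P Q = Σ (Fin n) λ v → v ∈ P × v ∈ Q × v ≢ x × v ≢ y

HasCISTs : {n : ℕ} (G : Graph n) (k : ℕ) → Set₁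
HasCISTs {n} G k = Σ (Fin k → SpanningTree G) λ T →
  ∀ (i j : Fin k) → i ≢ j → ∀ (x y : Fin n) (P Q : List (Fin n)) →
    IsPath (TAdj (T i)) x y P → IsPath (TAdj (T j)) x y Q →
    ¬ ShareEdge P Q × ¬ ShareInternal x y P Q

-- Split graphs: vertex partition D (inD v ≡ true) ∪ I (inD v ≡ false)

record SplitGraph {n : ℕ} (G : Graph n) : Set where
  field
    inD         : Fin n → Bool
    clique      : ∀ {x y} → inD x ≡ true → inD y ≡ true → x ≢ y → Adj G x y
    independent : ∀ {x y} → inD x ≡ false → inD y ≡ false → ¬ Adj G x y
    D-has-I-nbr : ∀ {x} → inD x ≡ true → Σ (Fin n) λ y → inD y ≡ false × Adj G x y
open SplitGraph public

-- Hypergraphs (hyperedges indexed, so repeated hyperedges are allowed)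

record Hypergraph : Set₁ where
  field
    Vtx    : Set
    EIdx   : Set
    member : EIdx → Vtx → Set
open Hypergraph public

-- H(G) = (D, { N_G(x) : x ∈ I })
H : {n : ℕ} {G : Graph n} → SplitGraph G → Hypergraph
H {n} {G} S = record
  { Vtx    = Σ (Fin n) λ v → inD S v ≡ true
  ; EIdx   = Σ (Fin n) λ x → inD S x ≡ false
  ; member = λ { (x , _) (v , _) → Adj G x v }
  }

IsPanchromatic : (Hg : Hypergraph) (k : ℕ) → (Vtx Hg → Fin k) → Set
IsPanchromatic Hg k c = ∀ (e : EIdx Hg) (j : Fin k) → Σ (Vtx Hg) λ v → member Hg e v × c v ≡ j

IsBipanchromatic : (Hg : Hypergraph) (k : ℕ) → (Vtx Hg → Fin k) → Set
IsBipanchromatic Hg k c = IsPanchromatic Hg k c ×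
  (∀ (j : Fin k) → Σ (Vtx Hg) λ u → Σ (Vtx Hg) λ v → u ≢ v × c u ≡ j × c v ≡ j)

HasBipanchromatic : (Hg : Hypergraph) (k : ℕ) → Set
HasBipanchromatic Hg k = Σ (Vtx Hg → Fin k) λ c → IsBipanchromatic Hg k c

-- Let D₁, …, D_k be the colour classes and a_j ≠ b_j two vertices of D_j. The tree T_j has
-- depth two: its root is a_j, the other vertices of D_j hang below a_j, each vertex of I hangs
-- below one of its neighbours in D_j (panchromaticity), and each vertex of D of another colour
-- hangs below a_j or b_j. Internal vertices of paths in T_j then lie in D_j, so paths in
-- different trees share no internal vertex; and an edge of both T_i and T_j would have to join
-- D_i to D_j, which the choice between a_j and b_j rules out.
module Submission where

open import Defs hiding (sym)
open import Axiom.UniquenessOfIdentityProofs using (module Decidable⇒UIP)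
open import Data.Bool using (true; false) renaming (_≟_ to _≟ᵇ_)
open import Data.Empty using (⊥; ⊥-elim)
open import Data.Fin using (Fin; _<_; _<?_) renaming (_≟_ to _≟ᶠ_)
open import Data.Fin.Properties using (<-asym; <-cmp; <-irrefl)
open import Data.List using ([]; _∷_)
open import Data.List.Membership.Propositional using (_∈_)
open import Data.List.Relation.Unary.All using (All; []; _∷_) renaming (lookup to All-lookup)
open import Data.List.Relation.Unary.All.Properties.Core using (¬Any⇒All¬)
open import Data.List.Relation.Unary.AllPairs.Core using ([]; _∷_)
open import Data.List.Relation.Unary.Any using (here; there)
open import Data.Nat using (ℕ; _≤_; s≤s)
open import Data.Product using (Σ; ∃; ∃₂; _×_; _,_; proj₁; proj₂)
open import Data.Sum using (_⊎_; inj₁; inj₂; [_,_]; map; swap)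
open import Function using (_∘_)
open import Relation.Binary.Definitions using (Tri; tri<; tri≈; tri>)
open import Relation.Binary.PropositionalEquality using (_≡_; _≢_; refl; sym; trans; cong; subst)
open import Relation.Nullary using (¬_; Dec; yes; no)
open import Relation.Nullary.Decidable using (_×-dec_; _⊎-dec_)

open Decidable⇒UIP _≟ᵇ_ using () renaming (≡-irrelevant to Bool-≡-irrelevant)

module _ {n : ℕ} {A : Fin n → Fin n → Set} where

  open import Data.List.Membership.DecPropositional (_≟ᶠ_ {n}) using (_∈?_)

  head∈walk : ∀ {x y vs} → Walk A x y vs → x ∈ vs
  head∈walk stop       = here refl
  head∈walk (step _ _) = here refl

  last∈walk : ∀ {x y vs} → Walk A x y vs → y ∈ vs
  last∈walk stop       = here refl
  last∈walk (step _ W) = there (last∈walk W)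

  walk-++ : ∀ {x y z vs ws} → Walk A x y vs → Walk A y z ws → ∃ (Walk A x z)
  walk-++ stop       W = _ , W
  walk-++ (step e V) W = _ , step e (proj₂ (walk-++ V W))

  walk-reverse : (∀ {x y} → A x y → A y x) → ∀ {x y vs} → Walk A x y vs → ∃ (Walk A y x)
  walk-reverse A-sym stop       = _ , stop
  walk-reverse A-sym (step e W) = walk-++ (proj₂ (walk-reverse A-sym W)) (step (A-sym e) stop)

  path-from : ∀ {x y v vs} → v ∈ vs → IsPath A x y vs → ∃ (IsPath A v y)
  path-from (here refl) P@(stop , _)            = _ , P
  path-from (here refl) P@(step _ _ , _)        = _ , P
  path-from (there v∈)  (step _ W , _ ∷ unique) = path-from v∈ (W , unique)

  walk⇒path : ∀ {x y vs} → Walk A x y vs → ∃ (IsPath A x y)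
  walk⇒path stop = _ , stop , [] ∷ []
  walk⇒path (step {x = x} e W) with walk⇒path W
  ... | ws , P with x ∈? ws
  ...   | yes x∈ = path-from x∈ P
  ...   | no x∉  = x ∷ ws , step e (proj₁ P) , ¬Any⇒All¬ ws x∉ ∷ proj₂ P

  EdgeOf⇒adjacent : ∀ {x y u v vs} → Walk A x y vs → EdgeOf vs u v → A u v
  EdgeOf⇒adjacent (step e stop)       here      = e
  EdgeOf⇒adjacent (step e (step _ _)) here      = e
  EdgeOf⇒adjacent (step _ W)          (there E) = EdgeOf⇒adjacent W E

  internal⇒between : ∀ {x y v vs} → IsPath A x y vs → v ∈ vs → v ≢ x → v ≢ y →
                     ∃₂ λ p q → A p v × A v q × p ≢ q
  internal⇒between (stop , _)     (here refl) v≢x _ = ⊥-elim (v≢x refl)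
  internal⇒between (step _ _ , _) (here refl) v≢x _ = ⊥-elim (v≢x refl)
  internal⇒between (step _ stop , _) (there (here refl)) _ v≢y = ⊥-elim (v≢y refl)
  internal⇒between (step e (step e′ W) , x∉ ∷ _) (there (here refl)) _ _ =
    _ , _ , e , e′ , All-lookup x∉ (there (head∈walk W))
  internal⇒between (step _ W@(step _ _) , _ ∷ unique@(x′∉ ∷ _)) (there (there v∈)) _ v≢y =
    internal⇒between (W , unique) (there v∈) (λ v≡x′ → All-lookup x′∉ v∈ (sym v≡x′)) v≢y

module DepthTwoTree {n : ℕ} (G : Graph n) (Inner : Fin n → Set) (root : Fin n)
  (parent : Fin n → Fin n)
  (parent-inner : ∀ v → Inner (parent v))
  (inner-parent : ∀ {v} → Inner v → parent v ≡ root)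
  (parent-adjacent : ∀ {v} → v ≢ root → Adj G v (parent v)) where

  ChildOf : Fin n → Fin n → Set
  ChildOf u v = u ≢ root × parent u ≡ v

  Edge : Fin n → Fin n → Set
  Edge u v = ChildOf u v ⊎ ChildOf v u

  Edge-sym : ∀ {u v} → Edge u v → Edge v u
  Edge-sym = swap

  Edge⇒Adj : ∀ {u v} → Edge u v → Adj G u v
  Edge⇒Adj (inj₁ (u≢r , refl)) = parent-adjacent u≢r
  Edge⇒Adj (inj₂ (v≢r , refl)) = Graph.sym G (parent-adjacent v≢r)

  walk-to-root : ∀ u → ∃ (Walk Edge u root)
  walk-to-root u with u ≟ᶠ root
  ... | yes refl = _ , stop
  ... | no u≢r with parent u ≟ᶠ root
  ...   | yes p≡r = _ , step (inj₁ (u≢r , p≡r)) stop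
  ...   | no p≢r  = _ , step (inj₁ (u≢r , refl))
                          (step (inj₁ (p≢r , inner-parent (parent-inner u))) stop)

  connected′ : Connected Edge
  connected′ x y = walk⇒path (proj₂ (walk-++ (proj₂ (walk-to-root x))
                                             (proj₂ (walk-reverse Edge-sym (proj₂ (walk-to-root y))))))

  -- A vertex outside Inner is a leaf: its only neighbour is its parent.
  between⇒inner : ∀ {p u q} → Edge p u → Edge u q → p ≢ q → Inner u
  between⇒inner (inj₁ (_ , refl)) _                 _   = parent-inner _
  between⇒inner (inj₂ _)          (inj₂ (_ , refl)) _   = parent-inner _
  between⇒inner (inj₂ (_ , refl)) (inj₁ (_ , refl)) p≢q = ⊥-elim (p≢q refl)

  inner-edge⇒root : ∀ {u v} → Edge u v → Inner u → Inner v → u ≡ root ⊎ v ≡ root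
  inner-edge⇒root (inj₁ (_ , refl)) u-inner _ = inj₂ (inner-parent u-inner)
  inner-edge⇒root (inj₂ (_ , refl)) _ v-inner = inj₁ (inner-parent v-inner)

  between-inner⇒root : ∀ {p u q} → Edge p u → Edge u q → p ≢ q → Inner p → Inner q → u ≡ root
  between-inner⇒root e e′ p≢q p-inner q-inner
    with inner-edge⇒root e p-inner u-inner | inner-edge⇒root e′ u-inner q-inner
    where u-inner = between⇒inner e e′ p≢q
  ... | inj₂ u≡r | _        = u≡r
  ... | _        | inj₁ u≡r = u≡r
  ... | inj₁ p≡r | inj₂ q≡r = ⊥-elim (p≢q (trans p≡r (sym q≡r)))

  -- On a cycle every vertex lies between two distinct neighbours, so two consecutive
  -- vertices of the cycle would both have to be the root.
  acyclic′ : ¬ HasCycle Edge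
  acyclic′ (_ , _ , _ , (stop , _) , s≤s () , _)
  acyclic′ (_ , _ , _ , (step _ stop , _) , s≤s (s≤s ()) , _)
  acyclic′ (_ , _ , _ , (step {y = v₁} e₁ (step {y = v₂} e₂ stop) ,
           (x≢v₁ ∷ x≢v₂ ∷ []) ∷ (v₁≢v₂ ∷ []) ∷ _) , _ , e₃) =
    x≢v₁ (trans x≡r (sym v₁≡r))
    where
    v₂≢v₁    = λ v₂≡v₁ → v₁≢v₂ (sym v₂≡v₁)
    x-inner  = between⇒inner e₃ e₁ v₂≢v₁
    v₁-inner = between⇒inner e₁ e₂ x≢v₂
    v₂-inner = between⇒inner e₂ e₃ (λ v₁≡x → x≢v₁ (sym v₁≡x))
    x≡r  = between-inner⇒root e₃ e₁ v₂≢v₁ v₂-inner v₁-inner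
    v₁≡r = between-inner⇒root e₁ e₂ x≢v₂ x-inner v₂-inner
  acyclic′ (x , y , _ , (step {y = v₁} e₁ (step {y = v₂} e₂ (step {y = v₃} e₃ W)) ,
           (_ ∷ x≢v₂ ∷ _) ∷ (v₁≢v₂ ∷ v₁∉) ∷ (v₂≢v₃ ∷ v₂∉) ∷ _) , _ , e₀) =
    v₁≢v₂ (trans v₁≡r (sym v₂≡r))
    where
    successor-of-v₃ : ∀ {ws} → Walk Edge v₃ y ws → All (v₂ ≢_) ws → ∃ λ q → Edge v₃ q × v₂ ≢ q
    successor-of-v₃ stop        _          = x , e₀ , λ v₂≡x → x≢v₂ (sym v₂≡x)
    successor-of-v₃ (step e W′) (_ ∷ v₂∉′) = _ , e , All-lookup v₂∉′ (head∈walk W′)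
    v₃-successor = successor-of-v₃ W (v₂≢v₃ ∷ v₂∉)
    x-inner  = between⇒inner e₀ e₁ (λ y≡v₁ → All-lookup v₁∉ (last∈walk W) (sym y≡v₁))
    v₁-inner = between⇒inner e₁ e₂ x≢v₂
    v₁≢v₃    = All-lookup v₁∉ (head∈walk W)
    v₂-inner = between⇒inner e₂ e₃ v₁≢v₃
    v₃-inner = between⇒inner e₃ (proj₁ (proj₂ v₃-successor)) (proj₂ (proj₂ v₃-successor))
    v₁≡r = between-inner⇒root e₁ e₂ x≢v₂ x-inner v₂-inner
    v₂≡r = between-inner⇒root e₂ e₃ v₁≢v₃ v₁-inner v₃-inner

  spanningTree : SpanningTree G
  spanningTree = record
    { TAdj = Edge ; sub = Edge⇒Adj ; tsym = Edge-sym ; connected = connected′ ; acyclic = acyclic′ }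

  path-internal⇒inner : ∀ {x y v vs} → IsPath Edge x y vs → v ∈ vs → v ≢ x → v ≢ y → Inner v
  path-internal⇒inner P v∈ v≢x v≢y with internal⇒between P v∈ v≢x v≢y
  ... | _ , _ , e , e′ , p≢q = between⇒inner e e′ p≢q

module SplitGraphTrees {n : ℕ} {G : Graph n} (S : SplitGraph G) {k : ℕ}
  (c : Vtx (H S) → Fin k) (panchromatic : IsPanchromatic (H S) k c)
  (twice : ∀ j → Σ (Vtx (H S)) λ u → Σ (Vtx (H S)) λ v → u ≢ v × c u ≡ j × c v ≡ j) where

  HasColour : Fin k → Fin n → Set
  HasColour j v = Σ (inD S v ≡ true) λ v∈D → c (v , v∈D) ≡ j

  D-vertex-≡ : {u v : Vtx (H S)} → proj₁ u ≡ proj₁ v → u ≡ v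
  D-vertex-≡ {_ , p} {_ , q} refl = cong (_ ,_) (Bool-≡-irrelevant p q)

  colour-unique : ∀ {i j v} → HasColour i v → HasColour j v → i ≡ j
  colour-unique (_ , refl) (_ , refl) = cong c (D-vertex-≡ refl)

  a b : Fin k → Fin n
  a j = proj₁ (proj₁ (twice j))
  b j = proj₁ (proj₁ (proj₂ (twice j)))

  a-colour : ∀ j → HasColour j (a j)
  a-colour j with twice j
  ... | (_ , a∈D) , _ , _ , ca , _ = a∈D , ca

  b-colour : ∀ j → HasColour j (b j)
  b-colour j with twice j
  ... | _ , (_ , b∈D) , _ , _ , cb = b∈D , cb

  a≢b : ∀ j → a j ≢ b j
  a≢b j a≡b = proj₁ (proj₂ (proj₂ (twice j))) (D-vertex-≡ a≡b)

  -- Tree j hangs every D-vertex of another colour below its root a j, except that for colours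
  -- l < j the vertex a l hangs below b j in tree j and b j below b l in tree l; otherwise the
  -- edge a j a l would lie in both trees.
  Rerouted : Fin k → Fin k → Fin n → Set
  Rerouted j l v = (j < l × v ≡ b l) ⊎ (l < j × v ≡ a l)

  rerouted? : ∀ j l v → Dec (Rerouted j l v)
  rerouted? j l v = (j <? l ×-dec v ≟ᶠ b l) ⊎-dec (l <? j ×-dec v ≟ᶠ a l)

  not-rerouted-own : ∀ j v → ¬ Rerouted j j v
  not-rerouted-own j v (inj₁ (j<j , _)) = <-irrefl refl j<j
  not-rerouted-own j v (inj₂ (j<j , _)) = <-irrefl refl j<j

  D-parent : Fin k → Fin k → Fin n → Fin n
  D-parent j l v with rerouted? j l v
  ... | yes _ = b j
  ... | no _  = a j

  D-parent-colour : ∀ j l v → HasColour j (D-parent j l v)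
  D-parent-colour j l v with rerouted? j l v
  ... | yes _ = b-colour j
  ... | no _  = a-colour j

  D-parent-rerouted : ∀ {j l v} → Rerouted j l v → D-parent j l v ≡ b j
  D-parent-rerouted {j} {l} {v} r with rerouted? j l v
  ... | yes _ = refl
  ... | no ¬r = ⊥-elim (¬r r)

  D-parent-default : ∀ {j l v} → ¬ Rerouted j l v → D-parent j l v ≡ a j
  D-parent-default {j} {l} {v} ¬r with rerouted? j l v
  ... | yes r = ⊥-elim (¬r r)
  ... | no _  = refl

  side : ∀ v → inD S v ≡ true ⊎ inD S v ≡ false
  side v with inD S v
  ... | true  = inj₁ refl
  ... | false = inj₂ refl

  parent : Fin k → Fin n → Fin n
  parent j v with side v
  ... | inj₁ v∈D = D-parent j (c (v , v∈D)) v
  ... | inj₂ v∈I = proj₁ (proj₁ (panchromatic (v , v∈I) j))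

  parent-colour : ∀ j v → HasColour j (parent j v)
  parent-colour j v with side v
  ... | inj₁ v∈D = D-parent-colour j (c (v , v∈D)) v
  ... | inj₂ v∈I = let (d , _ , cd) = panchromatic (v , v∈I) j in proj₂ d , cd

  parent-of-coloured : ∀ {j l v} → HasColour l v → parent j v ≡ D-parent j l v
  parent-of-coloured {j} {v = v} (v∈D , refl) with side v
  ... | inj₁ _    = cong (λ l → D-parent j l v) (cong c (D-vertex-≡ refl))
  ... | inj₂ v∈I  with () <- trans (sym v∈I) v∈D

  parent-of-own-colour : ∀ {j v} → HasColour j v → parent j v ≡ a j
  parent-of-own-colour {j} {v} v-j =
    trans (parent-of-coloured v-j) (D-parent-default (not-rerouted-own j v))

  parent-adjacent : ∀ j {v} → v ≢ a j → Adj G v (parent j v)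
  parent-adjacent j {v} v≢a = adjacent (parent-colour j v) v≢parent
    where
    v≢parent : v ≢ parent j v
    v≢parent v≡p =
      v≢a (trans v≡p (parent-of-own-colour (subst (HasColour j) (sym v≡p) (parent-colour j v))))
    adjacent : HasColour j (parent j v) → v ≢ parent j v → Adj G v (parent j v)
    adjacent (p∈D , _) v≢p with side v
    ... | inj₁ v∈D = clique S v∈D p∈D v≢p
    ... | inj₂ v∈I = proj₁ (proj₂ (panchromatic (v , v∈I) j))

  module Tree (j : Fin k) = DepthTwoTree G (HasColour j) (a j) (parent j)
    (parent-colour j) parent-of-own-colour (parent-adjacent j)

  parents-not-mutual : ∀ {i j x y} → i < j → HasColour j x → HasColour i y →
                       parent i x ≡ y → parent j y ≡ x → ⊥
  parents-not-mutual {i} {j} {x} {y} i<j x-j y-i px≡y py≡x with x ≟ᶠ b j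
  ... | yes x≡b = a≢b j (trans (sym x≡a) x≡b)
    where
    y≡b : y ≡ b i
    y≡b = trans (sym px≡y) (trans (parent-of-coloured x-j) (D-parent-rerouted (inj₁ (i<j , x≡b))))
    not-rerouted : ¬ Rerouted j i y
    not-rerouted (inj₁ (j<i , _)) = <-asym i<j j<i
    not-rerouted (inj₂ (_ , y≡a)) = a≢b i (trans (sym y≡a) y≡b)
    x≡a : x ≡ a j
    x≡a = trans (sym py≡x) (trans (parent-of-coloured y-i) (D-parent-default not-rerouted))
  ... | no x≢b = x≢b x≡b
    where
    not-rerouted : ¬ Rerouted i j x
    not-rerouted (inj₁ (_ , x≡b))  = x≢b x≡b
    not-rerouted (inj₂ (j<i , _)) = <-asym i<j j<i
    y≡a : y ≡ a i
    y≡a = trans (sym px≡y) (trans (parent-of-coloured x-j) (D-parent-default not-rerouted))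
    x≡b : x ≡ b j
    x≡b = trans (sym py≡x) (trans (parent-of-coloured y-i) (D-parent-rerouted (inj₂ (i<j , y≡a))))

  parent-edges-distinct : ∀ {i j x y} → i ≢ j → parent i x ≡ y → parent j x ≡ y ⊎ parent j y ≡ x → ⊥
  parent-edges-distinct {i} {j} {x} {y} i≢j px≡y (inj₁ p′x≡y) =
    i≢j (colour-unique (subst (HasColour i) px≡y (parent-colour i x))
                       (subst (HasColour j) p′x≡y (parent-colour j x)))
  parent-edges-distinct {i} {j} {x} {y} i≢j px≡y (inj₂ py≡x) = by-order (<-cmp i j)
    where
    x-j = subst (HasColour j) py≡x (parent-colour j y)
    y-i = subst (HasColour i) px≡y (parent-colour i x)
    by-order : Tri (i < j) (i ≡ j) (j < i) → ⊥
    by-order (tri< i<j _ _) = parents-not-mutual i<j x-j y-i px≡y py≡x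
    by-order (tri≈ _ i≡j _) = i≢j i≡j
    by-order (tri> _ _ j<i) = parents-not-mutual j<i y-i x-j py≡x px≡y

  tree-edges-disjoint : ∀ {i j u v} → i ≢ j → Tree.Edge i u v → Tree.Edge j u v → ⊥
  tree-edges-disjoint i≢j (inj₁ (_ , pu≡v)) e = parent-edges-distinct i≢j pu≡v (map proj₂ proj₂ e)
  tree-edges-disjoint i≢j (inj₂ (_ , pv≡u)) e = parent-edges-distinct i≢j pv≡u (swap (map proj₂ proj₂ e))

  no-shared-edge : ∀ {i j x y x′ y′ P Q} → i ≢ j →
    Walk (Tree.Edge i) x y P → Walk (Tree.Edge j) x′ y′ Q → ¬ ShareEdge P Q
  no-shared-edge {j = j} i≢j WP WQ (_ , _ , uv∈P , uv∈Q) =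
    tree-edges-disjoint i≢j (EdgeOf⇒adjacent WP uv∈P)
      ([ EdgeOf⇒adjacent WQ , Tree.Edge-sym j ∘ EdgeOf⇒adjacent WQ ] uv∈Q)

  no-shared-internal : ∀ {i j x y P Q} → i ≢ j →
    IsPath (Tree.Edge i) x y P → IsPath (Tree.Edge j) x y Q → ¬ ShareInternal x y P Q
  no-shared-internal {i} {j} i≢j PP PQ (_ , v∈P , v∈Q , v≢x , v≢y) =
    i≢j (colour-unique (Tree.path-internal⇒inner i PP v∈P v≢x v≢y)
                       (Tree.path-internal⇒inner j PQ v∈Q v≢x v≢y))

  completelyIndependent : HasCISTs G k
  completelyIndependent = Tree.spanningTree , λ i j i≢j x y P Q PP PQ →
    no-shared-edge i≢j (proj₁ PP) (proj₁ PQ) , no-shared-internal i≢j PP PQ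

-- The construction does not need k ≥ 2.
theorem5 : ∀ {n : ℕ} (G : Graph n) (S : SplitGraph G) (k : ℕ) → 2 ≤ k →
    HasBipanchromatic (H S) k → HasCISTs G k
theorem5 G S k _ (c , panchromatic , twice) =
  SplitGraphTrees.completelyIndependent S c panchromatic twice
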